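{- Let $n\ge1$ and $C=\{LT(\mathbf{m}_A[X_n]): A \text{ nonsplitable},\ \ell(A)\le n\}$. Then $C$ is a suffix set of the free monoid $X_n^*$: whenever $v\in C$ and $uv\in C$ for words $u,v\in X_n^*$, we have $u=\emptyset$.
   Context: $X_n=\{x_1<x_2<\dots<x_n\}$, $X_n^*$ the set of words (monomials in noncommuting variables). For a set partition $A\vdash[m]$ with blocks $A_1,\dots,A_{\ell(A)}$ ordered by increasing minimum, $\mathbf{m}_A[X_n]=\sum x_{i_1}\cdots x_{i_m}$ over sequences in $[n]^m$ with $i_a=i_b$ iff $a,b$ in the same block; $LT(\mathbf{m}_A[X_n])$ is its lexicographically smallest monomial, namely the word whose $k$-th letter is $x_i$ where $k\in A_i$. For $A\vdash[n']$ with $k$ blocks and $B\vdash[m]$ with $\ell$ blocks, $A\circ B\vdash[n'+m]$ consists of the blocks $A_i\cup(B_i+n')$ for $i\le\min(k,\ell)$ together with the remaining unpaired blocks $A_i$ or $B_i+n'$. A nonempty set partition $A$ is nonsplitable if it is not $B\circ C$ for nonempty set partitions $B,C$. -}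

module Defs where

open import Data.Nat using (ℕ; zero; suc; _+_; _≤_; _<_)
open import Data.Nat.Properties using (≤-trans)
open import Data.Fin using (Fin; toℕ; fromℕ<; splitAt; cast)
open import Data.Fin.Base using () renaming (_<_ to _<ᶠ_)
open import Data.List using (List; tabulate)
open import Data.Sum using (inj₁; inj₂)
open import Data.Product using (Σ; ∃; _×_; _,_)
open import Relation.Binary.PropositionalEquality using (_≡_)
open import Relation.Nullary using (¬_)

-- Its blocks A_1, …, A_ℓ are ordered by increasing minimum; we record
-- the partition by ℓ = `blocks` and the map `label` sending a point to the
-- (0-based) index of its block: p ∈ A_{label p + 1}.
record SetPartition (m : ℕ) : Set where
  field
    blocks   : ℕ
    label    : Fin m → ℕ
    label<   : ∀ p → label p < blocks
    nonempty : ∀ i → i < blocks → ∃ λ p → label p ≡ i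
    -- blocks are ordered by increasing minimum:
    -- for i < j, min A_i < min A_j, i.e. every element of A_j has an
    -- element of A_i before it
    ordered  : ∀ i j (p : Fin m) → i < j → label p ≡ j →
               ∃ λ (q : Fin m) → (q <ᶠ p) × label q ≡ i
open SetPartition public

-- Block labelling of A ∘ B (A ⊢ [n'], B ⊢ [m]): blocks A_i ∪ (B_i + n')
-- share label i; unpaired blocks keep their own index, which is the same
-- index in A ∘ B (the A-blocks come first by minimum).
∘-label : ∀ {n' m} → SetPartition n' → SetPartition m → Fin (n' + m) → ℕ
∘-label {n'} A B p with splitAt n' p
... | inj₁ a = label A a
... | inj₂ b = label B b

-- A is (literally) the composition B ∘ C: same ground set [n'+m] and same
-- blocks, listed in the same (canonical) order.
IsComposition : ∀ {N n' m} → SetPartition N → SetPartition n' → SetPartition m → Set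
IsComposition {N} {n'} {m} A B C =
  Σ (N ≡ n' + m) λ eq → ∀ (p : Fin N) → label A p ≡ ∘-label B C (cast eq p)

Nonsplitable : ∀ {N} → SetPartition N → Set
Nonsplitable {N} A =
  (1 ≤ N) ×
  ¬ (∃ λ n' → ∃ λ m → Σ (SetPartition n') λ B → Σ (SetPartition m) λ C →
       (1 ≤ n') × (1 ≤ m) × IsComposition A B C)

-- Letters x_1 < … < x_n are Fin n (x_{i+1} ↔ i); words are List (Fin n).
-- LT(m_A[X_n]) for ℓ(A) ≤ n: the k-th letter is x_i where k ∈ A_i.
LT : ∀ {N} n (A : SetPartition N) → blocks A ≤ n → List (Fin n)
LT n A h = tabulate λ p → fromℕ< (≤-trans (label< A p) h)

InC : ∀ n → List (Fin n) → Set
InC n w = ∃ λ N → Σ (SetPartition N) λ A → Nonsplitable A ×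
          Σ (blocks A ≤ n) λ h → LT n A h ≡ w

{-# OPTIONS --safe #-}
module Submission where

-- If u ≠ [] with v = LT(C) and u ++ v = LT(A), then A and C agree on the last
-- |v| points, since LT records the block labels letter by letter. Because the
-- blocks of A are ordered by their minima, every label occurring among the first
-- |u| points comes with all smaller labels occurring there too, so these points
-- carry a set partition B with the labels of A. Hence A = B ∘ C with both parts
-- nonempty, contradicting that A is nonsplitable.

open import Defs
open import Data.Nat using (ℕ; zero; suc; _+_; _≤_; _<_; z≤n; s≤s; s≤s⁻¹)
open import Data.Nat.Properties using (<-trans; m≤n⇒m<n∨m≡n)
open import Data.Fin using (Fin; toℕ; fromℕ<; splitAt; _↑ˡ_; _↑ʳ_)
  renaming (zero to fzero; suc to fsuc; _<_ to _<ᶠ_)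
open import Data.Fin.Properties
  using (toℕ<n; toℕ-↑ˡ; toℕ-fromℕ<; toℕ-injective; fromℕ<-injective; cast-is-id;
         splitAt⁻¹-↑ˡ; splitAt⁻¹-↑ʳ)
open import Data.List using (List; []; _∷_; _++_; tabulate; drop; length; allFin)
open import Data.List.Properties using (length-tabulate; length-++; ∷-injective)
open import Data.List.Extrema.Nat using (argmax; f[xs]≤f[argmax])
open import Data.List.Membership.Propositional.Properties using (∈-allFin)
import Data.List.Relation.Unary.All as All
open import Data.Sum using (inj₁; inj₂)
open import Data.Product using (∃; _×_; _,_; proj₁; proj₂)
open import Data.Empty using (⊥-elim)
open import Function using (_∘_)
open import Relation.Nullary using (¬_)
open import Relation.Binary.PropositionalEquality

private
  variable
    X : Set

drop-tabulate : ∀ k {M} (g : Fin (k + M) → X) →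
                drop k (tabulate g) ≡ tabulate (g ∘ (k ↑ʳ_))
drop-tabulate zero    g = refl
drop-tabulate (suc k) g = drop-tabulate k (g ∘ fsuc)

drop-length-++ : (u v : List X) → drop (length u) (u ++ v) ≡ v
drop-length-++ []      v = refl
drop-length-++ (_ ∷ u) v = drop-length-++ u v

tabulate-injective : ∀ {m} {g h : Fin m → X} → tabulate g ≡ tabulate h → ∀ i → g i ≡ h i
tabulate-injective e fzero    = proj₁ (∷-injective e)
tabulate-injective e (fsuc i) = tabulate-injective (proj₂ (∷-injective e)) i

below-↑ˡ : ∀ {k} M {q : Fin (k + M)} (a : Fin k) → q <ᶠ a ↑ˡ M →
           ∃ λ a′ → a′ ↑ˡ M ≡ q × a′ <ᶠ a
below-↑ˡ {k} M {q} a q<a↑ =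
  a′ , toℕ-injective (trans (toℕ-↑ˡ a′ M) a′≡q) , subst (_< toℕ a) (sym a′≡q) q<a
  where
  q<a : toℕ q < toℕ a
  q<a = subst (toℕ q <_) (toℕ-↑ˡ a M) q<a↑
  q<k : toℕ q < k
  q<k = <-trans q<a (toℕ<n a)
  a′ : Fin k
  a′ = fromℕ< q<k
  a′≡q : toℕ a′ ≡ toℕ q
  a′≡q = toℕ-fromℕ< q<k

module _ {k M : ℕ} (A : SetPartition (suc k + M)) where

  prefixLabel : Fin (suc k) → ℕ
  prefixLabel a = label A (a ↑ˡ M)

  -- Opaque because unfolding argmax during unification makes type checking very slow.
  opaque
    prefixTop : Fin (suc k)
    prefixTop = argmax prefixLabel fzero (allFin (suc k))

    prefixLabel≤top : ∀ a → prefixLabel a ≤ prefixLabel prefixTop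
    prefixLabel≤top a =
      All.lookup (f[xs]≤f[argmax] {f = prefixLabel} fzero (allFin (suc k))) (∈-allFin a)

  prefixLabel-ordered : ∀ i a → i < prefixLabel a →
                        ∃ λ a′ → a′ <ᶠ a × prefixLabel a′ ≡ i
  prefixLabel-ordered i a i<a with ordered A i (prefixLabel a) (a ↑ˡ M) i<a refl
  ... | q , q<a , lq≡i with below-↑ˡ M a q<a
  ...   | a′ , refl , a′<a = a′ , a′<a , lq≡i

  prefixLabel-onto : ∀ i → i ≤ prefixLabel prefixTop → ∃ λ a → prefixLabel a ≡ i
  prefixLabel-onto i i≤top with m≤n⇒m<n∨m≡n i≤top
  ... | inj₂ refl = prefixTop , refl
  ... | inj₁ i<top with prefixLabel-ordered i prefixTop i<top
  ...   | a , _ , la≡i = a , la≡i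

  prefixPartition : SetPartition (suc k)
  prefixPartition = record
    { blocks   = suc (prefixLabel prefixTop)
    ; label    = prefixLabel
    ; label<   = s≤s ∘ prefixLabel≤top
    ; nonempty = λ i i<blocks → prefixLabel-onto i (s≤s⁻¹ i<blocks)
    ; ordered  = λ { i _ a i<j refl → prefixLabel-ordered i a i<j }
    }

isComposition-by-labels : ∀ {k M} (A : SetPartition (k + M)) (B : SetPartition k)
                          (C : SetPartition M) →
                          (∀ a → label A (a ↑ˡ M) ≡ label B a) →
                          (∀ p → label A (k ↑ʳ p) ≡ label C p) →
                          IsComposition A B C
isComposition-by-labels {k} A B C onB onC =
  refl , λ p → trans (by-splitAt p) (cong (∘-label B C) (sym (cast-is-id refl p)))
  where
  by-splitAt : ∀ p → label A p ≡ ∘-label B C p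
  by-splitAt p with splitAt k p in e
  ... | inj₁ a = trans (cong (label A) (sym (splitAt⁻¹-↑ˡ e))) (onB a)
  ... | inj₂ c = trans (cong (label A) (sym (splitAt⁻¹-↑ʳ e))) (onC c)

nonsplitable⇒¬suffix-partition : ∀ {k M} (A : SetPartition (suc k + M)) →
                                  Nonsplitable A → (C : SetPartition M) → 1 ≤ M →
                                  ¬ (∀ p → label A (suc k ↑ʳ p) ≡ label C p)
nonsplitable⇒¬suffix-partition {k} {M} A (_ , unsplit) C 1≤M onC =
  unsplit (suc k , M , prefixPartition A , C , s≤s z≤n , 1≤M ,
           isComposition-by-labels A (prefixPartition A) C (λ _ → refl) onC)

drop-LT⇒label-↑ʳ : ∀ {n} k {M} (A : SetPartition (k + M)) (C : SetPartition M)
                   (hA : blocks A ≤ n) (hC : blocks C ≤ n) →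
                   drop k (LT n A hA) ≡ LT n C hC →
                   ∀ p → label A (k ↑ʳ p) ≡ label C p
drop-LT⇒label-↑ʳ k A C hA hC e p =
  fromℕ<-injective _ _ _ _ (tabulate-injective (trans (sym (drop-tabulate k _)) e) p)

LT-++-size : ∀ {n N M} (A : SetPartition N) (C : SetPartition M)
             (hA : blocks A ≤ n) (hC : blocks C ≤ n) (u : List (Fin n)) →
             LT n A hA ≡ u ++ LT n C hC → N ≡ length u + M
LT-++-size {n} {N} {M} A C hA hC u e = begin
  N                              ≡⟨ length-tabulate _ ⟨
  length (LT n A hA)             ≡⟨ cong length e ⟩
  length (u ++ LT n C hC)        ≡⟨ length-++ u ⟩
  length u + length (LT n C hC)  ≡⟨ cong (length u +_) (length-tabulate _) ⟩
  length u + M                   ∎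
  where open ≡-Reasoning

LT-not-proper-suffix : ∀ {n N M} (A : SetPartition N) (C : SetPartition M) →
                       Nonsplitable A → 1 ≤ M →
                       (hA : blocks A ≤ n) (hC : blocks C ≤ n) (x : Fin n) (u : List (Fin n)) →
                       LT n A hA ≢ (x ∷ u) ++ LT n C hC
LT-not-proper-suffix A C nsA 1≤M hA hC x u e with LT-++-size A C hA hC (x ∷ u) e
... | refl = nonsplitable⇒¬suffix-partition A nsA C 1≤M
               (drop-LT⇒label-↑ʳ (suc (length u)) A C hA hC
                 (trans (cong (drop (suc (length u))) e) (drop-length-++ (x ∷ u) _)))

mainTheorem18 : ∀ (n : ℕ) → 1 ≤ n → ∀ (u v : List (Fin n)) →
                InC n v → InC n (u ++ v) → u ≡ []
mainTheorem18 n _ []      v _ _ = refl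
mainTheorem18 n _ (x ∷ u) v (M , C , (1≤M , _) , hC , refl) (_ , A , nsA , hA , e) =
  ⊥-elim (LT-not-proper-suffix A C nsA 1≤M hA hC x u e)
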